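{- Let $f_0,\dots,f_{d-1}$ be pairwise co-prime positive integers, let $\mathcal{P}\ge 1$ be an integer, $n=\mathcal{P}\prod_{i=0}^{d-1}f_i$, $n_b=\sum_{i=0}^{d-1}f_i$, and let $k\ge 1$. Then the ensemble $\mathcal{C}_1^k(\mathcal{F},n_b)$ of bipartite graphs is identical to the ensemble $\mathcal{C}_2^k(\mathcal{F},n,n_b)$, where $\mathcal{F}=\{f_0,\dots,f_{d-1}\}$.
   Context: All graphs considered have $k$ variable (left) nodes and $n_b$ check (right) nodes, the check nodes being partitioned into $d$ subsets, the $i$-th subset having $f_i$ check nodes labelled $0,\dots,f_i-1$. $\mathcal{C}_1^k(\mathcal{F},n_b)$ ("balls-and-bins" ensemble): the set of $d$-left-regular bipartite graphs obtained by connecting each variable node to exactly one check node in each of the $d$ subsets (in the random model, chosen uniformly at random and independently). $\mathcal{C}_2^k(\mathcal{F},n,n_b)$ (CRT ensemble): for a set $\mathcal{I}$ of $k$ integers in $\{0,\dots,n-1\}$ assigned to the $k$ variable nodes in an arbitrary order, connect the variable node with associated integer $v$ to the check node $v \bmod f_i$ in subset $i$, for $i=0,\dots,d-1$; $\mathcal{C}_2^k(\mathcal{F},n,n_b)$ is the collection of all graphs induced by all possible sets $\mathcal{I}$ (sets with repeated elements allowed). -}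

module Defs where

open import Data.Nat using (ℕ; zero; suc; _*_; NonZero)
open import Data.Nat.DivMod using (_%_)
open import Data.Nat.Coprimality using (Coprime)
open import Data.Fin using (Fin; toℕ) renaming (zero to fzero; suc to fsuc)
open import Data.Bool using (Bool; true)
open import Data.Product using (∃; ∃!; _×_)
open import Relation.Binary.PropositionalEquality using (_≡_; _≢_)
open import Function.Bundles using (_⇔_)

prodF : (d : ℕ) → (Fin d → ℕ) → ℕ
prodF zero    f = 1
prodF (suc d) f = f fzero * prodF d (λ i → f (fsuc i))

PairwiseCoprime : (d : ℕ) → (Fin d → ℕ) → Set
PairwiseCoprime d f = ∀ (i j : Fin d) → i ≢ j → Coprime (f i) (f j)

-- A bipartite graph with k variable nodes and check nodes partitioned into
-- d subsets, subset i having f i check nodes labelled 0..f i - 1.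
-- G j i c ≡ true  iff variable node j is adjacent to check node c of subset i.
Graph : (k d : ℕ) → (Fin d → ℕ) → Set
Graph k d f = Fin k → (i : Fin d) → Fin (f i) → Bool

InC1 : (k d : ℕ) (f : Fin d → ℕ) → Graph k d f → Set
InC1 k d f G = ∀ (j : Fin k) (i : Fin d) → ∃! _≡_ (λ c → G j i c ≡ true)

-- Membership in C₂ᵏ(F, n, n_b): induced by some (multi)set of k integers in
-- {0,…,n-1}, assigned to variable nodes in some order (I j = integer of node j);
-- node with integer v is connected to check node (v mod f i) of subset i, only.
InC2 : (k d : ℕ) (f : Fin d → ℕ) (pos : ∀ i → NonZero (f i)) (n : ℕ) →
       Graph k d f → Set
InC2 k d f pos n G =
  ∃ λ (I : Fin k → Fin n) →
    ∀ (j : Fin k) (i : Fin d) (c : Fin (f i)) →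
      (G j i c ≡ true) ⇔ (toℕ c ≡ _%_ (toℕ (I j)) (f i) {{pos i}})

-- A node of C₂ with integer v is joined to exactly one check node per subset,
-- namely v mod fᵢ, so C₂ ⊆ C₁.  Conversely, a node of C₁ picks one check node
-- cᵢ in each subset, and by the Chinese remainder theorem some v < ∏ fᵢ ≤ n has
-- v mod fᵢ = cᵢ for all i.  The remainder theorem is proved by induction on d:
-- if v solves the last d − 1 congruences and B is the product of their moduli,
-- then v + B t solves them too, and t ↦ (v + B t) mod f₀ is injective on
-- t < f₀ because f₀ is coprime to B, hence surjective, so some t also solves
-- the first one.
module Submission where

open import Defs
open import Data.Nat using (ℕ; _*_; _≥_; NonZero)
open import Data.Fin using (Fin)
open import Function.Bundles using (_⇔_)

open import Data.Nat using (zero; suc; _+_; _∸_; _≤_; _<_; z≤n; s≤s; >-nonZero)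
open import Data.Nat.Properties
  using (1+n≰n; ≤-antisym; ≤-<-trans; <-≤-trans; m∸n≤m; m∸n≡0⇒m≤n; [m+n]∸[m+o]≡n∸o;
         *-comm; *-suc; *-distribˡ-∸; *-distribʳ-∸; +-monoˡ-<; *-monoʳ-≤; m≤n*m; module ≤-Reasoning)
open import Data.Nat.DivMod using (_%_; _/_; m≡m%n+[m/n]*n; m%n<n; %-remove-+ʳ)
open import Data.Nat.Divisibility
  using (_∣_; divides; ∣-trans; ∣1⇒≡1; m∣m*n; n∣m*n; ∣m⇒∣m*n; >⇒∤)
open import Data.Nat.Coprimality using (Coprime; coprime-divisor)
open import Data.Fin using (toℕ; fromℕ<; punchOut) renaming (zero to fzero; suc to fsuc)
open import Data.Fin.Properties
  using (toℕ-injective; toℕ-fromℕ<; toℕ<n; suc-injective; punchOut-injective; injective⇒≤; any?)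
  renaming (_≟_ to _≟ᶠ_)
open import Data.Product using (∃; ∃!; _×_; _,_; proj₁; proj₂)
open import Relation.Nullary using (yes; no; contradiction)
open import Relation.Binary.PropositionalEquality
open import Function using (_∘_)
open import Function.Bundles using (mk⇔; module Equivalence)
open import Function.Definitions using (Injective)
import Function.Properties.Equivalence as ⇔

injective⇒surjective : ∀ {n} (g : Fin n → Fin n) → Injective _≡_ _≡_ g →
                       ∀ y → ∃ λ x → g x ≡ y
injective⇒surjective {suc m} g g-inj y with any? (λ x → g x ≟ᶠ y)
... | yes hit = hit
... | no miss = contradiction (injective⇒≤ skip-y-inj) 1+n≰n
  where
  skip-y : Fin (suc m) → Fin m
  skip-y x = punchOut {i = y} (miss ∘ (x ,_) ∘ sym)

  skip-y-inj : Injective _≡_ _≡_ skip-y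
  skip-y-inj = g-inj ∘ punchOut-injective {i = y} _ _

m%n≡o%n⇒n∣o∸m : ∀ m o n .{{_ : NonZero n}} → m % n ≡ o % n → n ∣ o ∸ m
m%n≡o%n⇒n∣o∸m m o n eq = divides (o / n ∸ m / n) (begin
  o ∸ m                                       ≡⟨ cong₂ _∸_ (m≡m%n+[m/n]*n o n) (m≡m%n+[m/n]*n m n) ⟩
  (o % n + o / n * n) ∸ (m % n + m / n * n)   ≡⟨ cong (λ r → (o % n + o / n * n) ∸ (r + m / n * n)) eq ⟩
  (o % n + o / n * n) ∸ (o % n + m / n * n)   ≡⟨ [m+n]∸[m+o]≡n∸o (o % n) _ _ ⟩
  o / n * n ∸ m / n * n                       ≡⟨ *-distribʳ-∸ n (o / n) (m / n) ⟨
  (o / n ∸ m / n) * n                         ∎)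
  where open ≡-Reasoning

∣-<⇒≡0 : ∀ {m n} → m ∣ n → n < m → n ≡ 0
∣-<⇒≡0 {n = zero}  _   _   = refl
∣-<⇒≡0 {n = suc _} m∣n n<m = contradiction m∣n (>⇒∤ n<m)

module _ {a : ℕ} .{{_ : NonZero a}} (B v : ℕ) (a⊥B : Coprime a B) where

  progression-%-injective : ∀ {t u} → t < a → u < a →
                            (v + B * t) % a ≡ (v + B * u) % a → t ≡ u
  progression-%-injective t<a u<a eq = ≤-antisym (≤-from t<a (sym eq)) (≤-from u<a eq)
    where
    ≤-from : ∀ {t u} → u < a → (v + B * t) % a ≡ (v + B * u) % a → u ≤ t
    ≤-from {t} {u} u<a eq = m∸n≡0⇒m≤n (∣-<⇒≡0 a∣u∸t (≤-<-trans (m∸n≤m u t) u<a))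
      where
      a∣u∸t : a ∣ u ∸ t
      a∣u∸t = coprime-divisor a⊥B (subst (a ∣_)
        (trans ([m+n]∸[m+o]≡n∸o v (B * u) (B * t)) (sym (*-distribˡ-∸ B u t)))
        (m%n≡o%n⇒n∣o∸m _ _ a eq))

  progression-%-surjective : (c : Fin a) → ∃ λ t → t < a × (v + B * t) % a ≡ toℕ c
  progression-%-surjective c = toℕ s , toℕ<n s , trans (sym (toℕ-fromℕ< _)) (cong toℕ gs≡c)
    where
    residue : Fin a → Fin a
    residue t = fromℕ< (m%n<n (v + B * toℕ t) a)

    residue-inj : Injective _≡_ _≡_ residue
    residue-inj {t} {u} eq = toℕ-injective (progression-%-injective (toℕ<n t) (toℕ<n u)
      (trans (sym (toℕ-fromℕ< _)) (trans (cong toℕ eq) (toℕ-fromℕ< _))))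

    preimage : ∃ λ s → residue s ≡ c
    preimage = injective⇒surjective residue residue-inj c

    s : Fin a
    s = proj₁ preimage

    gs≡c : residue s ≡ c
    gs≡c = proj₂ preimage

m+n*o<p*n : ∀ {m n o p} → m < n → o < p → m + n * o < p * n
m+n*o<p*n {m} {n} {o} {p} m<n o<p = begin-strict
  m + n * o      <⟨ +-monoˡ-< (n * o) m<n ⟩
  n + n * o      ≡⟨ *-suc n o ⟨
  n * suc o      ≤⟨ *-monoʳ-≤ n o<p ⟩
  n * p          ≡⟨ *-comm n p ⟩
  p * n          ∎
  where open ≤-Reasoning

coprime-* : ∀ {a b c} → Coprime a b → Coprime a c → Coprime a (b * c)
coprime-* a⊥b a⊥c (e∣a , e∣bc) = a⊥c (e∣a , coprime-divisor e⊥b e∣bc)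
  where
  e⊥b : Coprime _ _
  e⊥b (g∣e , g∣b) = a⊥b (∣-trans g∣e e∣a , g∣b)

coprime-prodF : ∀ {a} d (f : Fin d → ℕ) → (∀ i → Coprime a (f i)) → Coprime a (prodF d f)
coprime-prodF zero    f a⊥f (_ , e∣1) = ∣1⇒≡1 e∣1
coprime-prodF (suc d) f a⊥f = coprime-* (a⊥f fzero) (coprime-prodF d (f ∘ fsuc) (a⊥f ∘ fsuc))

∣-prodF : ∀ d (f : Fin d → ℕ) i → f i ∣ prodF d f
∣-prodF (suc d) f fzero    = m∣m*n _
∣-prodF (suc d) f (fsuc i) = ∣-trans (∣-prodF d (f ∘ fsuc) i) (n∣m*n (f fzero))

chinese-remainder : ∀ d (f : Fin d → ℕ) (pos : ∀ i → NonZero (f i)) → PairwiseCoprime d f →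
                    (c : (i : Fin d) → Fin (f i)) →
                    ∃ λ v → v < prodF d f × ∀ i → _%_ v (f i) {{pos i}} ≡ toℕ (c i)
chinese-remainder zero    f pos f⊥ c = 0 , s≤s z≤n , λ ()
chinese-remainder (suc d) f pos f⊥ c = v + B * t , m+n*o<p*n v<B t<f₀ , residues
  where
  instance
    f₀≢0 : NonZero (f fzero)
    f₀≢0 = pos fzero

  B : ℕ
  B = prodF d (f ∘ fsuc)

  tail-solution : ∃ λ v → v < B × ∀ i → _%_ v (f (fsuc i)) {{pos (fsuc i)}} ≡ toℕ (c (fsuc i))
  tail-solution = chinese-remainder d (f ∘ fsuc) (pos ∘ fsuc)
                    (λ i j i≢j → f⊥ (fsuc i) (fsuc j) (i≢j ∘ suc-injective)) (c ∘ fsuc)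

  v : ℕ
  v = proj₁ tail-solution

  v<B : v < B
  v<B = proj₁ (proj₂ tail-solution)

  f₀⊥B : Coprime (f fzero) B
  f₀⊥B = coprime-prodF d (f ∘ fsuc) (λ i → f⊥ fzero (fsuc i) λ ())

  head-solution : ∃ λ t → t < f fzero × (v + B * t) % f fzero ≡ toℕ (c fzero)
  head-solution = progression-%-surjective B v f₀⊥B (c fzero)

  t : ℕ
  t = proj₁ head-solution

  t<f₀ : t < f fzero
  t<f₀ = proj₁ (proj₂ head-solution)

  residues : ∀ i → _%_ (v + B * t) (f i) {{pos i}} ≡ toℕ (c i)
  residues fzero    = proj₂ (proj₂ head-solution)
  residues (fsuc i) = trans (%-remove-+ʳ v {{pos (fsuc i)}} (∣m⇒∣m*n t (∣-prodF d (f ∘ fsuc) i)))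
                            (proj₂ (proj₂ tail-solution) i)

∃!⇒⇔≡ : ∀ {A : Set} {P : A → Set} (u : ∃! _≡_ P) → ∀ y → P y ⇔ y ≡ proj₁ u
∃!⇒⇔≡ (x , Px , unique) y = mk⇔ (sym ∘ unique) (λ { refl → Px })

⇔≡⇒∃! : ∀ {A : Set} {P : A → Set} {x} → (∀ y → P y ⇔ y ≡ x) → ∃! _≡_ P
⇔≡⇒∃! {x = x} P⇔≡x = x , Equivalence.from (P⇔≡x x) refl , sym ∘ Equivalence.to (P⇔≡x _)

≡⇔toℕ≡ : ∀ {n} {x : Fin n} {m} → toℕ x ≡ m → ∀ y → y ≡ x ⇔ toℕ y ≡ m
≡⇔toℕ≡ refl y = mk⇔ (cong toℕ) toℕ-injective

lemma1 : (d : ℕ) (f : Fin d → ℕ) (pos : ∀ i → NonZero (f i)) →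
    PairwiseCoprime d f →
    (P : ℕ) → P ≥ 1 → (k : ℕ) → k ≥ 1 →
    ∀ (G : Graph k d f) → InC1 k d f G ⇔ InC2 k d f pos (P * prodF d f) G
lemma1 d f pos f⊥ P P≥1 k _ G = mk⇔ C₁⇒C₂ C₂⇒C₁
  where
  instance
    fᵢ≢0 : ∀ {i} → NonZero (f i)
    fᵢ≢0 = pos _

  C₁⇒C₂ : InC1 k d f G → InC2 k d f pos (P * prodF d f) G
  C₁⇒C₂ unique = I , λ j i c → ⇔.trans (∃!⇒⇔≡ (unique j i) c) (≡⇔toℕ≡ (residue j i) c)
    where
    solution : ∀ j → ∃ λ v → v < prodF d f × ∀ i → v % f i ≡ toℕ (proj₁ (unique j i))
    solution j = chinese-remainder d f pos f⊥ (λ i → proj₁ (unique j i))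

    I : Fin k → Fin (P * prodF d f)
    I j = fromℕ< (<-≤-trans (proj₁ (proj₂ (solution j))) (m≤n*m _ P {{>-nonZero P≥1}}))

    residue : ∀ j i → toℕ (proj₁ (unique j i)) ≡ toℕ (I j) % f i
    residue j i = sym (trans (cong (_% f i) (toℕ-fromℕ< _)) (proj₂ (proj₂ (solution j)) i))

  C₂⇒C₁ : InC2 k d f pos (P * prodF d f) G → InC1 k d f G
  C₂⇒C₁ (I , adjacent) j i =
    ⇔≡⇒∃! (λ c → ⇔.trans (adjacent j i c) (⇔.sym (≡⇔toℕ≡ (toℕ-fromℕ< (m%n<n (toℕ (I j)) (f i))) c)))
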